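{- Let $\mathcal{A} = (A_{ij}(x))$ be a $p\times q$ matrix of formal power series in $\mathbb{R}[[x]]$. If $\mathcal{A}$ is fully interlacing, then so are the matrices $\mathcal{S}^{(r)}\mathcal{A}$ and $\mathcal{S}^{(r)\perp}\mathcal{A}$ for every positive integer $r$.
   Context: A $\mathbb{Z}\times\mathbb{Z}$ real matrix is totally positive (TP) if every finite square submatrix has nonnegative determinant. For a $p\times q$ matrix $\mathcal{A} = (A_{ij}(x))_{0\le i<p,\,0\le j<q}$ of formal power series $A_{ij}(x) = \sum_{n\ge 0} a_{ij}(n)x^n$ (with $a_{ij}(n) = 0$ for $n<0$), $\mathrm{Lace}(\mathcal{A}) = (M_{uv})_{u,v\in\mathbb{Z}}$ is defined by writing $u = pu'+i$, $v = qv'+j$ with $u',v'\in\mathbb{Z}$, $0\le i<p$, $0\le j<q$, and setting $M_{uv} = a_{ij}(v'-u')$. $\mathcal{A}$ is fully interlacing if $\mathrm{Lace}(\mathcal{A})$ is TP. For integers $0\le k<r$ and $A(x)=\sum_{n\ge0}a_nx^n$, the $k$th Veronese $r$-section is $\mathcal{S}_k^{(r)}A(x) = \sum_{n\ge 0} a_{k+rn}x^n$; $\mathcal{S}_k^{(r)}\mathcal{A}$ denotes the $p\times q$ matrix $(\mathcal{S}_k^{(r)}A_{ij}(x))$. Then $\mathcal{S}^{(r)}\mathcal{A}$ is the $p\times rq$ block matrix $(\mathcal{S}_0^{(r)}\mathcal{A}\ \ \mathcal{S}_1^{(r)}\mathcal{A}\ \cdots\ \mathcal{S}_{r-1}^{(r)}\mathcal{A})$,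 and $\mathcal{S}^{(r)\perp}\mathcal{A}$ is the $rp\times q$ block matrix whose blocks from top to bottom are $\mathcal{S}_{r-1}^{(r)}\mathcal{A}, \dots, \mathcal{S}_1^{(r)}\mathcal{A}, \mathcal{S}_0^{(r)}\mathcal{A}$. -}

module Defs where

open import Level using (Level; _⊔_)
open import Data.Nat as ℕ using (ℕ; zero; suc; NonZero)
open import Data.Integer as ℤ using (ℤ; +_; -[1+_]; _/ℕ_; _%ℕ_)
open import Data.Integer.DivMod using (n%ℕd<d)
open import Data.Fin as Fin using (Fin; zero; suc; toℕ; fromℕ<; punchIn; remQuot; opposite)
open import Data.Product using (_×_; _,_; Σ)
open import Algebra.Bundles using (CommutativeRing)
open import Relation.Binary.Structures using (IsTotalOrder)
open import Relation.Nullary using (¬_)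

-- The real numbers, axiomatised as a (Dedekind-)complete ordered field.
-- Any such structure is isomorphic to ℝ, so quantifying over all of
-- them is the same as speaking about ℝ.

record CompleteOrderedField (c ℓ₁ ℓ₂ : Level) : Set (Level.suc (c ⊔ ℓ₁ ⊔ ℓ₂)) where
  field
    commutativeRing : CommutativeRing c ℓ₁
  open CommutativeRing commutativeRing public
  field
    _≤_          : Carrier → Carrier → Set ℓ₂
    isTotalOrder : IsTotalOrder _≈_ _≤_
    +-mono-≤     : ∀ {x y} z → x ≤ y → (x + z) ≤ (y + z)
    *-nonneg     : ∀ {x y} → 0# ≤ x → 0# ≤ y → 0# ≤ (x * y)
    0≉1          : ¬ (0# ≈ 1#)
    inverse      : ∀ x → ¬ (x ≈ 0#) → Σ Carrier (λ y → (x * y) ≈ 1#)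
    complete     : (P : Carrier → Set c) → Σ Carrier P →
                   Σ Carrier (λ b → ∀ x → P x → x ≤ b) →
                   Σ Carrier (λ s → (∀ x → P x → x ≤ s) ×
                                    (∀ b → (∀ x → P x → x ≤ b) → s ≤ b))

module _ {c ℓ₁ ℓ₂ : Level} (F : CompleteOrderedField c ℓ₁ ℓ₂) where
  open CompleteOrderedField F using (Carrier; _≈_; _+_; _*_; -_; 0#; 1#; _≤_)

  Series : Set c
  Series = ℕ → Carrier

  SeriesMatrix : ℕ → ℕ → Set c
  SeriesMatrix p q = Fin p → Fin q → Series

  coeffℤ : Series → ℤ → Carrier
  coeffℤ a (+ n)    = a n
  coeffℤ a -[1+ n ] = 0#

  sumFin : ∀ n → (Fin n → Carrier) → Carrier
  sumFin zero    f = 0#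
  sumFin (suc n) f = f zero + sumFin n (λ i → f (suc i))

  sign : ℕ → Carrier
  sign zero    = 1#
  sign (suc k) = - (sign k)

  det : ∀ n → (Fin n → Fin n → Carrier) → Carrier
  det zero    M = 1#
  det (suc n) M = sumFin (suc n) (λ j →
    sign (toℕ j) * (M zero j * det n (λ a b → M (suc a) (punchIn j b))))

  StrictlyIncreasing : ∀ {k} → (Fin k → ℤ) → Set
  StrictlyIncreasing {k} f = ∀ (a b : Fin k) → a Fin.< b → f a ℤ.< f b

  TotallyPositive : (ℤ → ℤ → Carrier) → Set (ℓ₂)
  TotallyPositive M =
    ∀ (k : ℕ) (f g : Fin k → ℤ) → StrictlyIncreasing f → StrictlyIncreasing g →
    0# ≤ det k (λ a b → M (f a) (g b))

  -- Lace(A) : u = p u' + i , v = q v' + j ,  M_{uv} = a_{ij}(v' - u')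
  Lace : ∀ p q .{{_ : NonZero p}} .{{_ : NonZero q}} → SeriesMatrix p q → ℤ → ℤ → Carrier
  Lace p q A u v =
    coeffℤ (A (fromℕ< (n%ℕd<d u p)) (fromℕ< (n%ℕd<d v q))) ((v /ℕ q) ℤ.- (u /ℕ p))

  FullyInterlacing : ∀ p q .{{_ : NonZero p}} .{{_ : NonZero q}} → SeriesMatrix p q → Set ℓ₂
  FullyInterlacing p q A = TotallyPositive (Lace p q A)

  section : ∀ r → Fin r → Series → Series
  section r k a n = a (toℕ k ℕ.+ r ℕ.* n)

  -- S^(r) A = ( S_0 A  S_1 A  ...  S_{r-1} A ) : a p × rq matrix
  -- (column k*q + j of the block matrix is column j of block k)
  S^ : ∀ {p q} r → SeriesMatrix p q → SeriesMatrix p (r ℕ.* q)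
  S^ {p} {q} r A i c with remQuot {r} q c
  ... | k , j = section r k (A i j)

  -- S^(r)⊥ A : an rp × q matrix, blocks top to bottom S_{r-1} A, ..., S_0 A
  -- (row m*p + i is row i of block m, which is S_{r-1-m} A)
  S^⊥ : ∀ {p q} r → SeriesMatrix p q → SeriesMatrix (r ℕ.* p) q
  S^⊥ {p} {q} r A c j with remQuot {r} p c
  ... | m , i = section r (opposite m) (A i j)

{-# OPTIONS --safe #-}
module Submission where

-- Write u = p u′ + i and v = r q v′ + q k + j.  The (u, v) entry of Lace (S^ r A) is
-- a_ij (k + r (v′ − u′)), which is the entry of Lace A in row r p u′ + i and column v.
-- So Lace (S^ r A) is the submatrix of Lace A on the rows picked by the strictly increasing
-- map u ↦ (u mod p) + r (u div p) p.  Likewise Lace (S^⊥ r A) is the submatrix of Lace A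
-- on the rows u ↦ u − (r − 1) p and the columns v ↦ (v mod q) + r (v div q) q, and a
-- square submatrix of a submatrix taken along increasing maps is a square submatrix of Lace A.

open import Defs
open import Level using (Level)
open import Data.Nat as ℕ using (ℕ; suc; NonZero)
open import Data.Nat.Properties using (m*n≢0)
open import Data.Product using (_×_; _,_; proj₁; proj₂; uncurry)

module _ where

  open import Data.Integer as ℤ using (ℤ; +_; -[1+_]; _/ℕ_; _%ℕ_; _+_; _*_; _-_; _<_; _≤_; +<+; -<+; 0ℤ; 1ℤ)
  open import Data.Integer.Properties
  open import Data.Integer.DivMod using (n%ℕd<d; a≡a%ℕn+[a/ℕn]*n; [n/ℕd]*d≤n; n<s[n/ℕd]*d)
  open import Data.Integer.Tactic.RingSolver using (solve-∀)
  open import Algebra.Properties.AbelianGroup +-0-abelianGroup using (∙-cancelʳ)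
  open import Data.Fin as Fin using (Fin; toℕ; fromℕ<; remQuot; opposite; punchIn)
  open import Data.Fin.Properties using (toℕ-fromℕ<; toℕ-injective; toℕ<n; combine-remQuot; toℕ-combine; opposite-prop)
  open import Function using (id; _∘_)
  open import Relation.Binary.Core using (_Preserves_⟶_)
  open import Relation.Binary.PropositionalEquality

  module _ (d : ℕ) .{{_ : NonZero d}} where

    private
      quotient-≤ : ∀ {x y n} → x * + d ≤ n → n < ℤ.suc y * + d → x ≤ y
      quotient-≤ {x} {y} x*d≤n n<[1+y]*d = subst (x ≤_) (pred-suc y)
        (i<j⇒i≤pred[j] (*-cancelʳ-<-nonNeg {x} {ℤ.suc y} (+ d) (≤-<-trans x*d≤n n<[1+y]*d)))

    /ℕ-monoˡ-≤ : ∀ {n n′} → n ≤ n′ → n /ℕ d ≤ n′ /ℕ d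
    /ℕ-monoˡ-≤ {n} {n′} n≤n′ =
      quotient-≤ (≤-trans ([n/ℕd]*d≤n n d) n≤n′) (n<s[n/ℕd]*d n′ d)

    module _ {i : ℕ} (i<d : i ℕ.< d) (q : ℤ) where

      [i+q*d]/ℕd≡q : (+ i + q * + d) /ℕ d ≡ q
      [i+q*d]/ℕd≡q = ≤-antisym
        (quotient-≤ ([n/ℕd]*d≤n n d) n<[1+q]*d)
        (quotient-≤ (i≤j+i (q * + d) (+ i)) (n<s[n/ℕd]*d n d))
        where
        n = + i + q * + d
        n<[1+q]*d : n < ℤ.suc q * + d
        n<[1+q]*d = subst (n <_) (sym (suc-* q (+ d))) (+-monoˡ-< (q * + d) (+<+ i<d))

      [i+q*d]%ℕd≡i : (+ i + q * + d) %ℕ d ≡ i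
      [i+q*d]%ℕd≡i = +-injective (∙-cancelʳ (q * + d) _ _ (begin
        + (n %ℕ d) + q * + d       ≡⟨ cong (λ x → + (n %ℕ d) + x * + d) [i+q*d]/ℕd≡q ⟨
        + (n %ℕ d) + n /ℕ d * + d  ≡⟨ a≡a%ℕn+[a/ℕn]*n n d ⟨
        n                          ∎))
        where
        open ≡-Reasoning
        n = + i + q * + d

    fromℕ<-[i+q*d]%ℕd : ∀ (i : Fin d) q → fromℕ< (n%ℕd<d (+ toℕ i + q * + d) d) ≡ i
    fromℕ<-[i+q*d]%ℕd i q = toℕ-injective (trans (toℕ-fromℕ< _) ([i+q*d]%ℕd≡i (toℕ<n i) q))

    dilate : ℕ → ℤ → ℤ
    dilate r u = + (u %ℕ d) + (+ r * (u /ℕ d)) * + d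

    dilate-mono-< : ∀ r .{{_ : NonZero r}} → dilate r Preserves _<_ ⟶ _<_
    dilate-mono-< (suc r) {u} {u′} u<u′ = subst₂ _<_ (dilate-suc u) (dilate-suc u′)
      (+-mono-<-≤ u<u′ (*-monoʳ-≤-nonNeg (+ d) (*-monoˡ-≤-nonNeg (+ r) (/ℕ-monoˡ-≤ (<⇒≤ u<u′)))))
      where
      dilate-suc : ∀ u → u + + r * (u /ℕ d) * + d ≡ dilate (suc r) u
      dilate-suc u = begin
        u + + r * (u /ℕ d) * + d
          ≡⟨ cong (_+ + r * (u /ℕ d) * + d) (a≡a%ℕn+[a/ℕn]*n u d) ⟩
        + (u %ℕ d) + u /ℕ d * + d + + r * (u /ℕ d) * + d
          ≡⟨ rearrange (+ (u %ℕ d)) (u /ℕ d) (+ d) (+ r) ⟩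
        + (u %ℕ d) + ((1ℤ + + r) * (u /ℕ d)) * + d
          ∎
        where
        open ≡-Reasoning
        rearrange : ∀ I Q D R → I + Q * D + R * Q * D ≡ I + ((1ℤ + R) * Q) * D
        rearrange = solve-∀

  module _ (r d : ℕ) .{{_ : NonZero r}} .{{_ : NonZero d}} where

    private instance
      r*d≢0 : NonZero (r ℕ.* d)
      r*d≢0 = m*n≢0 r d

    block : ℤ → Fin r
    block u = proj₁ (remQuot d (fromℕ< (n%ℕd<d u (r ℕ.* d))))

    offset : ℤ → Fin d
    offset u = proj₂ (remQuot {r} d (fromℕ< (n%ℕd<d u (r ℕ.* d))))

    block-decomposition : ∀ u →
      u ≡ + toℕ (offset u) + (u /ℕ (r ℕ.* d) * + r + + toℕ (block u)) * + d
    block-decomposition u = begin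
      u                                              ≡⟨ a≡a%ℕn+[a/ℕn]*n u (r ℕ.* d) ⟩
      + (u %ℕ (r ℕ.* d)) + Q * + (r ℕ.* d)           ≡⟨ cong₂ (λ c rd → + c + Q * rd) %ℕ-blocks (pos-* r d) ⟩
      + (d ℕ.* k ℕ.+ i) + Q * (+ r * + d)            ≡⟨ cong (_+ Q * (+ r * + d)) (pos-+ (d ℕ.* k) i) ⟩
      + (d ℕ.* k) + + i + Q * (+ r * + d)            ≡⟨ cong (λ x → x + + i + Q * (+ r * + d)) (pos-* d k) ⟩
      + d * + k + + i + Q * (+ r * + d)              ≡⟨ rearrange (+ d) (+ k) (+ i) Q (+ r) ⟩
      + i + (Q * + r + + k) * + d                    ∎
      where
      open ≡-Reasoning
      Q = u /ℕ (r ℕ.* d)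
      c = fromℕ< (n%ℕd<d u (r ℕ.* d))
      k = toℕ (block u)
      i = toℕ (offset u)
      %ℕ-blocks : u %ℕ (r ℕ.* d) ≡ d ℕ.* k ℕ.+ i
      %ℕ-blocks = begin
        u %ℕ (r ℕ.* d)                               ≡⟨ toℕ-fromℕ< (n%ℕd<d u (r ℕ.* d)) ⟨
        toℕ c                                        ≡⟨ cong toℕ (combine-remQuot {r} d c) ⟨
        toℕ (uncurry Fin.combine (remQuot {r} d c))  ≡⟨ toℕ-combine (block u) (offset u) ⟩
        d ℕ.* k ℕ.+ i                                ∎
      rearrange : ∀ D K I Q R → D * K + I + Q * (R * D) ≡ I + (Q * R + K) * D
      rearrange = solve-∀

    shifted-block-decomposition : ∀ u → u + (+ d - + r * + d)
      ≡ + toℕ (offset u) + (u /ℕ (r ℕ.* d) * + r - + toℕ (opposite (block u))) * + d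
    shifted-block-decomposition u = begin
      u + (+ d - + r * + d)
        ≡⟨ cong (_+ (+ d - + r * + d)) (block-decomposition u) ⟩
      + i + (Q * + r + + m) * + d + (+ d - + r * + d)
        ≡⟨ rearrange (+ i) (+ d) Q (+ r) (+ m) ⟩
      + i + (Q * + r - (+ r - + suc m)) * + d
        ≡⟨ cong (λ x → + i + (Q * + r - x) * + d) r-[1+m]≡o ⟩
      + i + (Q * + r - + o) * + d
        ∎
      where
      open ≡-Reasoning
      Q = u /ℕ (r ℕ.* d)
      m = toℕ (block u)
      i = toℕ (offset u)
      o = toℕ (opposite (block u))
      rearrange : ∀ I D Q R M → I + (Q * R + M) * D + (D - R * D) ≡ I + (Q * R - (R - (1ℤ + M))) * D
      rearrange = solve-∀
      r-[1+m]≡o : + r - + suc m ≡ + o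
      r-[1+m]≡o = begin
        + r - + suc m    ≡⟨ m-n≡m⊖n r (suc m) ⟩
        r ℤ.⊖ suc m      ≡⟨ ⊖-≥ (toℕ<n (block u)) ⟩
        + (r ℕ.∸ suc m)  ≡⟨ cong +_ (opposite-prop (block u)) ⟨
        + o              ∎

  module _ {c ℓ₁ ℓ₂ : Level} (F : CompleteOrderedField c ℓ₁ ℓ₂) where

    open CompleteOrderedField F using (Carrier; 0#) renaming (_+_ to _+ᶠ_; _*_ to _*ᶠ_; _≤_ to _≤ᶠ_)

    sumFin-cong : ∀ n {f g : Fin n → Carrier} → (∀ i → f i ≡ g i) → sumFin F n f ≡ sumFin F n g
    sumFin-cong ℕ.zero    f≡g = refl
    sumFin-cong (suc n) f≡g = cong₂ _+ᶠ_ (f≡g Fin.zero) (sumFin-cong n (λ i → f≡g (Fin.suc i)))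

    det-cong : ∀ n {M N : Fin n → Fin n → Carrier} → (∀ a b → M a b ≡ N a b) → det F n M ≡ det F n N
    det-cong ℕ.zero    M≡N = refl
    det-cong (suc n) M≡N = sumFin-cong (suc n) λ j →
      cong₂ (λ x y → sign F (toℕ j) *ᶠ (x *ᶠ y)) (M≡N Fin.zero j)
        (det-cong n (λ a b → M≡N (Fin.suc a) (punchIn j b)))

    TotallyPositive-resp : ∀ {M N : ℤ → ℤ → Carrier} →
      (∀ u v → M u v ≡ N u v) → TotallyPositive F M → TotallyPositive F N
    TotallyPositive-resp M≡N tp k f g f↑ g↑ =
      subst (0# ≤ᶠ_) (det-cong k (λ a b → M≡N (f a) (g b))) (tp k f g f↑ g↑)

    TotallyPositive-submatrix : ∀ {M : ℤ → ℤ → Carrier} {φ ψ : ℤ → ℤ} →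
      φ Preserves _<_ ⟶ _<_ → ψ Preserves _<_ ⟶ _<_ →
      TotallyPositive F M → TotallyPositive F (λ u v → M (φ u) (ψ v))
    TotallyPositive-submatrix {φ = φ} {ψ} φ↑ ψ↑ tp k f g f↑ g↑ =
      tp k (φ ∘ f) (ψ ∘ g) (λ a b a<b → φ↑ (f↑ a b a<b)) (λ a b a<b → ψ↑ (g↑ a b a<b))

    coeffℤ-neg : ∀ (a : Series F) {z} → z < 0ℤ → coeffℤ F a z ≡ 0#
    coeffℤ-neg a { -[1+ _ ]} _ = refl
    coeffℤ-neg a {+ _} (+<+ ())

    coeffℤ-section : ∀ r (k : Fin r) (a : Series F) z →
      coeffℤ F (section F r k a) z ≡ coeffℤ F a (+ toℕ k + + r * z)
    coeffℤ-section r k a (+ n) =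
      cong (coeffℤ F a) (trans (pos-+ (toℕ k) (r ℕ.* n)) (cong (_+_ (+ toℕ k)) (pos-* r n)))
    coeffℤ-section r k a z@(-[1+ _ ]) = sym (coeffℤ-neg a (begin-strict
      + toℕ k + + r * z   <⟨ +-monoˡ-< (+ r * z) (+<+ (toℕ<n k)) ⟩
      + r + + r * z       ≡⟨ *-suc (+ r) z ⟨
      + r * ℤ.suc z       ≤⟨ *-monoˡ-≤-nonNeg (+ r) (i<j⇒suc[i]≤j {z} -<+) ⟩
      + r * 0ℤ            ≡⟨ *-zeroʳ (+ r) ⟩
      0ℤ                  ∎))
      where open ≤-Reasoning

    module _ {p q : ℕ} .{{p≢0 : NonZero p}} .{{q≢0 : NonZero q}} (A : SeriesMatrix F p q) where

      Lace-at : ∀ (i : Fin p) (j : Fin q) (s t : ℤ) →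
        Lace F p q A (+ toℕ i + s * + p) (+ toℕ j + t * + q) ≡ coeffℤ F (A i j) (t - s)
      Lace-at i j s t = trans
        (cong₂ (λ i′ j′ → coeffℤ F (A i′ j′) (v /ℕ q - u /ℕ p))
               (fromℕ<-[i+q*d]%ℕd p i s) (fromℕ<-[i+q*d]%ℕd q j t))
        (cong₂ (λ s′ t′ → coeffℤ F (A i j) (t′ - s′))
               ([i+q*d]/ℕd≡q p (toℕ<n i) s) ([i+q*d]/ℕd≡q q (toℕ<n j) t))
        where
        u = + toℕ i + s * + p
        v = + toℕ j + t * + q

      module _ (r : ℕ) .{{_ : NonZero r}} where

        Lace-S^ : ∀ u v → Lace F p (r ℕ.* q) {{p≢0}} {{m*n≢0 r q}} (S^ F r A) u v
                          ≡ Lace F p q A (dilate p r u) v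
        Lace-S^ u v = begin
          Lace F p (r ℕ.* q) (S^ F r A) u v
            ≡⟨⟩
          coeffℤ F (section F r k (A i j)) (Qv - Qu)
            ≡⟨ coeffℤ-section r k (A i j) (Qv - Qu) ⟩
          coeffℤ F (A i j) (+ toℕ k + + r * (Qv - Qu))
            ≡⟨ cong (coeffℤ F (A i j)) (rearrange (+ toℕ k) (+ r) Qu Qv) ⟩
          coeffℤ F (A i j) ((Qv * + r + + toℕ k) - + r * Qu)
            ≡⟨ Lace-at i j (+ r * Qu) (Qv * + r + + toℕ k) ⟨
          Lace F p q A (+ toℕ i + (+ r * Qu) * + p) (+ toℕ j + (Qv * + r + + toℕ k) * + q)
            ≡⟨ cong₂ (Lace F p q A) (cong (λ x → + x + (+ r * Qu) * + p) (toℕ-fromℕ< (n%ℕd<d u p)))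
                                    (sym (block-decomposition r q v)) ⟩
          Lace F p q A (dilate p r u) v
            ∎
          where
          open ≡-Reasoning
          instance
            r*q≢0 : NonZero (r ℕ.* q)
            r*q≢0 = m*n≢0 r q
          i = fromℕ< (n%ℕd<d u p)
          Qu = u /ℕ p
          k = block r q v
          j = offset r q v
          Qv = v /ℕ (r ℕ.* q)
          rearrange : ∀ K R U V → K + R * (V - U) ≡ (V * R + K) - R * U
          rearrange = solve-∀

        Lace-S^⊥ : ∀ u v → Lace F (r ℕ.* p) q {{m*n≢0 r p}} {{q≢0}} (S^⊥ F r A) u v
                           ≡ Lace F p q A (u + (+ p - + r * + p)) (dilate q r v)
        Lace-S^⊥ u v = begin
          Lace F (r ℕ.* p) q (S^⊥ F r A) u v
            ≡⟨⟩
          coeffℤ F (section F r (opposite m) (A i j)) (Qv - Qu)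
            ≡⟨ coeffℤ-section r (opposite m) (A i j) (Qv - Qu) ⟩
          coeffℤ F (A i j) (+ o + + r * (Qv - Qu))
            ≡⟨ cong (coeffℤ F (A i j)) (rearrange (+ o) (+ r) Qu Qv) ⟩
          coeffℤ F (A i j) (+ r * Qv - (Qu * + r - + o))
            ≡⟨ Lace-at i j (Qu * + r - + o) (+ r * Qv) ⟨
          Lace F p q A (+ toℕ i + (Qu * + r - + o) * + p) (+ toℕ j + (+ r * Qv) * + q)
            ≡⟨ cong₂ (Lace F p q A) (sym (shifted-block-decomposition r p u))
                                    (cong (λ x → + x + (+ r * Qv) * + q) (toℕ-fromℕ< (n%ℕd<d v q))) ⟩
          Lace F p q A (u + (+ p - + r * + p)) (dilate q r v)
            ∎
          where
          open ≡-Reasoning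
          instance
            r*p≢0 : NonZero (r ℕ.* p)
            r*p≢0 = m*n≢0 r p
          m = block r p u
          i = offset r p u
          Qu = u /ℕ (r ℕ.* p)
          o = toℕ (opposite m)
          j = fromℕ< (n%ℕd<d v q)
          Qv = v /ℕ q
          rearrange : ∀ O R U V → O + R * (V - U) ≡ R * V - (U * R - O)
          rearrange = solve-∀

        FullyInterlacing-S^ : FullyInterlacing F p q A →
          FullyInterlacing F p (r ℕ.* q) {{p≢0}} {{m*n≢0 r q}} (S^ F r A)
        FullyInterlacing-S^ fi = TotallyPositive-resp (λ u v → sym (Lace-S^ u v))
          (TotallyPositive-submatrix {M = Lace F p q A} (dilate-mono-< p r) id fi)

        FullyInterlacing-S^⊥ : FullyInterlacing F p q A →
          FullyInterlacing F (r ℕ.* p) q {{m*n≢0 r p}} {{q≢0}} (S^⊥ F r A)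
        FullyInterlacing-S^⊥ fi = TotallyPositive-resp (λ u v → sym (Lace-S^⊥ u v))
          (TotallyPositive-submatrix {M = Lace F p q A} (+-monoˡ-< (+ p - + r * + p)) (dilate-mono-< q r) fi)

open import Data.Nat using (_*_)

theorem5p3 : ∀ {c ℓ₁ ℓ₂ : Level} (F : CompleteOrderedField c ℓ₁ ℓ₂)
               (p q : ℕ) .{{p≢0 : NonZero p}} .{{q≢0 : NonZero q}} (A : SeriesMatrix F p q) →
               FullyInterlacing F p q A →
               ∀ (r : ℕ) .{{r≢0 : NonZero r}} →
               FullyInterlacing F p (r * q) {{p≢0}} {{m*n≢0 r q}} (S^ F r A)
               × FullyInterlacing F (r * p) q {{m*n≢0 r p}} {{q≢0}} (S^⊥ F r A)
theorem5p3 F p q A fi r = FullyInterlacing-S^ F A r fi , FullyInterlacing-S^⊥ F A r fi
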